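{- Let $a, b$ be nonzero integers with $\gcd(a,b)=1$. Then $$a\,(a^{ -1})_{b}+b\,(b^{ -1})_{a}=1+a\,b.$$
   Context: For nonzero integers $a, m$ with $\gcd(a,m)=1$, the modular inverse $(a^{ -1})_m$ is the integer $x$ defined as follows: if $m>1$, $x$ is the unique integer with $1\le x\le m-1$ and $ax\equiv 1 \pmod m$; if $m<-1$, $x$ is the unique integer with $m+1\le x\le -1$ and $ax\equiv 1\pmod m$; if $|m|=1$, $x=\tfrac12|m|(\operatorname{sgn}(m)-\operatorname{sgn}(a))+\operatorname{sgn}(a)$. (Thus $(a^{ -1})_1=1$ if $a>0$, $0$ if $a<0$; $(a^{ -1})_{ -1}=0$ if $a>0$, $-1$ if $a<0$.) $(a^{ -1})_m$ is undefined if $am=0$ or $\gcd(a,m)\ne1$. -}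

module Defs where

open import Data.Integer
open import Data.Integer.Divisibility using (_∣_)
open import Data.Product using (_×_)
open import Data.Sum using (_⊎_)
open import Relation.Binary.PropositionalEquality using (_≡_)

_≡1mod_ : ℤ → ℤ → Set
t ≡1mod m = m ∣ (t - 1ℤ)

sgn : ℤ → ℤ
sgn (+ 0) = 0ℤ
sgn +[1+ _ ] = 1ℤ
sgn -[1+ _ ] = -1ℤ

-- IsModInv a m x : x is (a^{-1})_m, exactly following the definition
-- (the paper's value is undefined when a m = 0; we only use it under a, m ≠ 0)
IsModInv : ℤ → ℤ → ℤ → Set
IsModInv a m x =
    (1ℤ < m × 1ℤ ≤ x × x ≤ m - 1ℤ × (a * x) ≡1mod m)
  ⊎ (m < -1ℤ × m + 1ℤ ≤ x × x ≤ -1ℤ × (a * x) ≡1mod m)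
  ⊎ (∣ m ∣ ≡ 1 × (+ 2) * x ≡ (+ ∣ m ∣) * (sgn m - sgn a) + (+ 2) * sgn a)

-- Let D = a x + b y - 1 - a b.  Since b divides a x - 1 and a divides b y - 1, both a and b
-- divide D, hence so does a b by coprimality.  The normalisation of the inverses puts a x and
-- b y in the same half-open interval (0, a b] or (a b, 0], which forces |D| < |a b|, so D = 0.
-- Existence comes from Bézout, reducing the cofactor modulo b into the prescribed range.
module Submission where

open import Defs
open import Data.Integer
open import Data.Integer.GCD using (gcd)
open import Data.Product using (_×_; ∃; _,_)
open import Relation.Binary.PropositionalEquality
  using (_≡_; _≢_; refl; sym; trans; cong; subst; module ≡-Reasoning)

import Data.Nat as ℕ
import Data.Nat.Properties as ℕₚ
import Data.Nat.Divisibility as ℕ∣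
import Data.Nat.Coprimality as ℕᶜ
import Data.Nat.GCD as ℕᵍ
open ℕ using (zero; z≤n; s≤s)
open import Data.Integer.Properties
open import Data.Integer.Divisibility.Signed
open import Data.Integer.Coprimality using (Coprime; coprime-divisor) renaming (sym to coprime-sym)
open import Data.Integer.DivMod using (_%_; _/_; a≡a%n+[a/n]*n; n%d<d)
open import Data.Integer.Tactic.RingSolver using (solve-∀)
open import Data.Sum using (_⊎_; inj₁; inj₂)
open import Relation.Nullary using (contradiction)

defect : ℤ → ℤ → ℤ → ℤ → ℤ
defect a b x y = a * x + b * y - 1ℤ - a * b

defect-sym : ∀ a b x y → defect a b x y ≡ defect b a y x
defect-sym = swap
  where
  swap : ∀ a b x y → a * x + b * y - 1ℤ - a * b ≡ b * y + a * x - 1ℤ - b * a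
  swap = solve-∀

∣⇒∣defect : ∀ a b x y → b ∣ a * x - 1ℤ → b ∣ defect a b x y
∣⇒∣defect a b x y b∣ax-1 =
  subst (b ∣_) (expand a b x y) (∣m∣n⇒∣m+n b∣ax-1 (∣n⇒∣m*n (y - a) ∣-refl))
  where
  expand : ∀ a b x y → (a * x - 1ℤ) + (y - a) * b ≡ a * x + b * y - 1ℤ - a * b
  expand = solve-∀

defect≡0⇒a*x+b*y≡1+a*b : ∀ a b x y → defect a b x y ≡ 0ℤ → a * x + b * y ≡ 1ℤ + a * b
defect≡0⇒a*x+b*y≡1+a*b a b x y D≡0 = begin
  a * x + b * y    ≡⟨ shift (a * x + b * y) ⟩
  1ℤ + (a * x + b * y - 1ℤ)
    ≡⟨ cong (λ t → 1ℤ + t) (i-j≡0⇒i≡j (a * x + b * y - 1ℤ) (a * b) D≡0) ⟩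
  1ℤ + a * b       ∎
  where
  open ≡-Reasoning
  shift : ∀ t → t ≡ 1ℤ + (t - 1ℤ)
  shift = solve-∀

coprime-∣⇒*∣ : ∀ {a b n} → Coprime a b → a ∣ n → b ∣ n → a * b ∣ n
coprime-∣⇒*∣ {a} {b} {n} coprime a∣n (divides q n≡q*b) = divides (quotient a∣q) (begin
  n                    ≡⟨ n≡q*b ⟩
  q * b                ≡⟨ cong (_* b) (_∣_.equality a∣q) ⟩
  quotient a∣q * a * b ≡⟨ *-assoc (quotient a∣q) a b ⟩
  quotient a∣q * (a * b) ∎)
  where
  open ≡-Reasoning
  a∣q : a ∣ q
  a∣q = ∣ᵤ⇒∣ (coprime-divisor a b q coprime
    (∣⇒∣ᵤ (subst (a ∣_) (trans n≡q*b (*-comm q b)) a∣n)))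

-j<i<j⇒∣i∣<∣j∣ : ∀ {i j} → - j < i → i < j → ∣ i ∣ ℕ.< ∣ j ∣
-j<i<j⇒∣i∣<∣j∣ {+ _}      {+ _}       _         (+<+ m<n) = m<n
-j<i<j⇒∣i∣<∣j∣ { -[1+ _ ]} {+[1+ _ ]}  (-<- n<m) _         = s≤s n<m
-j<i<j⇒∣i∣<∣j∣ {i}        { -[1+ _ ]}  -j<i      i<j       = contradiction (<-trans i<j -<+) (<-asym -j<i)

∣∧∣i∣<∣j∣⇒≡0 : ∀ {i j} → j ∣ i → ∣ i ∣ ℕ.< ∣ j ∣ → i ≡ 0ℤ
∣∧∣i∣<∣j∣⇒≡0 {+0}       _   _ = refl
∣∧∣i∣<∣j∣⇒≡0 {+[1+ _ ]} j∣i lt = contradiction (∣⇒∣ᵤ j∣i) (ℕ∣.>⇒∤ lt)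
∣∧∣i∣<∣j∣⇒≡0 { -[1+ _ ]} j∣i lt = contradiction (∣⇒∣ᵤ j∣i) (ℕ∣.>⇒∤ lt)

-- Half-open so that it also contains a (a⁻¹)_b ∈ {0, a b}, the values arising when |b| = 1.
HalfOpenBetween0 : ℤ → ℤ → Set
HalfOpenBetween0 P u = (0ℤ < u × u ≤ P) ⊎ (P < u × u ≤ 0ℤ)

StrictlyBetween0 : ℤ → ℤ → Set
StrictlyBetween0 m x = (0ℤ < x × x < m) ⊎ (m < x × x < 0ℤ)

strictlyBetween0⇒halfOpenBetween0 : ∀ {m x} → StrictlyBetween0 m x → HalfOpenBetween0 m x
strictlyBetween0⇒halfOpenBetween0 (inj₁ (0<x , x<m)) = inj₁ (0<x , <⇒≤ x<m)
strictlyBetween0⇒halfOpenBetween0 (inj₂ (m<x , x<0)) = inj₂ (m<x , <⇒≤ x<0)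

*-pres-strictlyBetween0 : ∀ {a m x} → a ≢ 0ℤ → StrictlyBetween0 m x → StrictlyBetween0 (a * m) (a * x)
*-pres-strictlyBetween0 {+0} a≢0 _ = contradiction refl a≢0
*-pres-strictlyBetween0 {a@(+[1+ _ ])} _ (inj₁ (0<x , x<m)) =
  inj₁ (subst (_< a * _) (*-zeroʳ a) (*-monoˡ-<-pos a 0<x) , *-monoˡ-<-pos a x<m)
*-pres-strictlyBetween0 {a@(+[1+ _ ])} _ (inj₂ (m<x , x<0)) =
  inj₂ (*-monoˡ-<-pos a m<x , subst (a * _ <_) (*-zeroʳ a) (*-monoˡ-<-pos a x<0))
*-pres-strictlyBetween0 { a@(-[1+ _ ])} _ (inj₁ (0<x , x<m)) =
  inj₂ (*-monoˡ-<-neg a x<m , subst (a * _ <_) (*-zeroʳ a) (*-monoˡ-<-neg a 0<x))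
*-pres-strictlyBetween0 { a@(-[1+ _ ])} _ (inj₂ (m<x , x<0)) =
  inj₁ (subst (_< a * _) (*-zeroʳ a) (*-monoˡ-<-neg a x<0) , *-monoˡ-<-neg a m<x)

isModInv⇒∣ : ∀ {a m x} → IsModInv a m x → m ∣ a * x - 1ℤ
isModInv⇒∣ (inj₁ (_ , _ , _ , m∣ax-1))        = ∣ᵤ⇒∣ m∣ax-1
isModInv⇒∣ (inj₂ (inj₁ (_ , _ , _ , m∣ax-1))) = ∣ᵤ⇒∣ m∣ax-1
isModInv⇒∣ {a} {x = x} (inj₂ (inj₂ (∣m∣≡1 , _))) =
  ∣ᵤ⇒∣ (subst (ℕ∣._∣ ∣ a * x - 1ℤ ∣) (sym ∣m∣≡1) (ℕ∣.1∣ _))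

isModInv⇒halfOpenBetween0 : ∀ {a m x} → a ≢ 0ℤ → IsModInv a m x → HalfOpenBetween0 (a * m) (a * x)
isModInv⇒halfOpenBetween0 {m = m} {x} a≢0 (inj₁ (_ , 1≤x , x≤m-1 , _)) =
  strictlyBetween0⇒halfOpenBetween0 (*-pres-strictlyBetween0 a≢0
    (inj₁ (suc[i]≤j⇒i<j 1≤x , i≤pred[j]⇒i<j (subst (x ≤_) (+-comm m -1ℤ) x≤m-1))))
isModInv⇒halfOpenBetween0 {m = m} {x} a≢0 (inj₂ (inj₁ (_ , m+1≤x , x≤-1 , _))) =
  strictlyBetween0⇒halfOpenBetween0 (*-pres-strictlyBetween0 a≢0
    (inj₂ (suc[i]≤j⇒i<j (subst (_≤ x) (+-comm m 1ℤ) m+1≤x) , i≤pred[j]⇒i<j x≤-1)))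
isModInv⇒halfOpenBetween0 {+0} a≢0 _ = contradiction refl a≢0
isModInv⇒halfOpenBetween0 {a@(+[1+ _ ])} {+[1+ 0 ]} {x} _ (inj₂ (inj₂ (_ , 2x≡2)))
  with refl ← *-cancelˡ-≡ (+ 2) x 1ℤ 2x≡2 = inj₁ (+<+ (s≤s z≤n) , ≤-refl)
isModInv⇒halfOpenBetween0 {a@(-[1+ _ ])} {+[1+ 0 ]} {x} _ (inj₂ (inj₂ (_ , 2x≡0)))
  with refl ← *-cancelˡ-≡ (+ 2) x 0ℤ 2x≡0 =
    inj₂ (subst (a * 1ℤ <_) (sym (*-zeroʳ a)) -<+ , ≤-reflexive (*-zeroʳ a))
isModInv⇒halfOpenBetween0 {a@(+[1+ _ ])} { -[1+ 0 ]} {x} _ (inj₂ (inj₂ (_ , 2x≡0)))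
  with refl ← *-cancelˡ-≡ (+ 2) x 0ℤ 2x≡0 =
    inj₂ (subst (a * -1ℤ <_) (sym (*-zeroʳ a)) -<+ , ≤-reflexive (*-zeroʳ a))
isModInv⇒halfOpenBetween0 {a@(-[1+ _ ])} { -[1+ 0 ]} {x} _ (inj₂ (inj₂ (_ , 2x≡-2)))
  with refl ← *-cancelˡ-≡ (+ 2) x -1ℤ 2x≡-2 = inj₁ (+<+ (s≤s z≤n) , ≤-refl)

window-bound : ∀ {l h u v} → l < u → u ≤ h → l < v → v ≤ h →
  ∣ u + v - 1ℤ - (l + h) ∣ ℕ.< ∣ h - l ∣
window-bound {l} {h} {u} {v} l<u u≤h l<v v≤h = -j<i<j⇒∣i∣<∣j∣ lower upper
  where
  open ≤-Reasoning
  shift : ∀ {s t} → s ≤ t → s - 1ℤ - (l + h) ≤ t - 1ℤ - (l + h)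
  shift s≤t = +-monoˡ-≤ (- (l + h)) (+-monoˡ-≤ -1ℤ s≤t)
  lower-id : ∀ l h → 1ℤ + - (h - l) ≡ (1ℤ + l) + (1ℤ + l) - 1ℤ - (l + h)
  lower-id = solve-∀
  upper-id : ∀ l h → 1ℤ + (h + h - 1ℤ - (l + h)) ≡ h - l
  upper-id = solve-∀
  lower : - (h - l) < u + v - 1ℤ - (l + h)
  lower = suc[i]≤j⇒i<j (begin
    1ℤ + - (h - l)                           ≡⟨ lower-id l h ⟩
    (1ℤ + l) + (1ℤ + l) - 1ℤ - (l + h)
      ≤⟨ shift (+-mono-≤ (i<j⇒suc[i]≤j l<u) (i<j⇒suc[i]≤j l<v)) ⟩
    u + v - 1ℤ - (l + h)                     ∎)
  upper : u + v - 1ℤ - (l + h) < h - l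
  upper = suc[i]≤j⇒i<j (begin
    1ℤ + (u + v - 1ℤ - (l + h))              ≤⟨ +-monoʳ-≤ 1ℤ (shift (+-mono-≤ u≤h v≤h)) ⟩
    1ℤ + (h + h - 1ℤ - (l + h))              ≡⟨ upper-id l h ⟩
    h - l                                    ∎)

halfOpenBetween0-bound : ∀ {P u v} → HalfOpenBetween0 P u → HalfOpenBetween0 P v →
  ∣ u + v - 1ℤ - P ∣ ℕ.< ∣ P ∣
halfOpenBetween0-bound {+0} (inj₁ (0<u , u≤0)) _ = contradiction (<-≤-trans 0<u u≤0) (<-irrefl refl)
halfOpenBetween0-bound {+0} (inj₂ (0<u , u≤0)) _ = contradiction (<-≤-trans 0<u u≤0) (<-irrefl refl)
halfOpenBetween0-bound {P@(+[1+ k ])} {u} {v} (inj₁ (0<u , u≤P)) (inj₁ (0<v , v≤P)) =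
  subst (∣ u + v - 1ℤ - P ∣ ℕ.<_) (ℕₚ.+-identityʳ (ℕ.suc k)) (window-bound 0<u u≤P 0<v v≤P)
halfOpenBetween0-bound {+[1+ _ ]} _ (inj₂ (P<v , v≤0)) = contradiction (<-≤-trans P<v v≤0) λ { (+<+ ()) }
halfOpenBetween0-bound {+[1+ _ ]} (inj₂ (P<u , u≤0)) _ = contradiction (<-≤-trans P<u u≤0) λ { (+<+ ()) }
halfOpenBetween0-bound { -[1+ _ ]} (inj₂ (P<u , u≤0)) (inj₂ (P<v , v≤0)) = window-bound P<u u≤0 P<v v≤0
halfOpenBetween0-bound { -[1+ _ ]} _ (inj₁ (0<v , v≤P)) = contradiction (<-≤-trans 0<v v≤P) λ ()
halfOpenBetween0-bound { -[1+ _ ]} (inj₁ (0<u , u≤P)) _ = contradiction (<-≤-trans 0<u u≤P) λ ()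

isModInv-sum : ∀ {a b x y} → a ≢ 0ℤ → b ≢ 0ℤ → Coprime a b →
  IsModInv a b x → IsModInv b a y → a * x + b * y ≡ 1ℤ + a * b
isModInv-sum {a} {b} {x} {y} a≢0 b≢0 coprime x-inv y-inv =
  defect≡0⇒a*x+b*y≡1+a*b a b x y (∣∧∣i∣<∣j∣⇒≡0 ab∣D ∣D∣<∣ab∣)
  where
  ab∣D : a * b ∣ defect a b x y
  ab∣D = coprime-∣⇒*∣ coprime
    (subst (a ∣_) (defect-sym b a y x) (∣⇒∣defect b a y x (isModInv⇒∣ y-inv)))
    (∣⇒∣defect a b x y (isModInv⇒∣ x-inv))
  ∣D∣<∣ab∣ : ∣ defect a b x y ∣ ℕ.< ∣ a * b ∣
  ∣D∣<∣ab∣ = halfOpenBetween0-bound (isModInv⇒halfOpenBetween0 a≢0 x-inv)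
    (subst (λ P → HalfOpenBetween0 P (b * y)) (*-comm b a) (isModInv⇒halfOpenBetween0 b≢0 y-inv))

i*±1≡∣i∣ : ∀ i → ∃ λ e → i * e ≡ + ∣ i ∣
i*±1≡∣i∣ (+ n)      = 1ℤ , *-identityʳ (+ n)
i*±1≡∣i∣ -[1+ n ]   = -1ℤ , trans (*-comm -[1+ n ] -1ℤ) (-1*i≡-i -[1+ n ])

pos-1+m*A≡n*B : ∀ m A n B → 1 ℕ.+ m ℕ.* A ≡ n ℕ.* B → 1ℤ + + m * + A ≡ + n * + B
pos-1+m*A≡n*B m A n B eq = begin
  1ℤ + + m * + A    ≡⟨ cong (λ t → 1ℤ + t) (sym (pos-* m A)) ⟩
  + (1 ℕ.+ m ℕ.* A) ≡⟨ cong +_ eq ⟩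
  + (n ℕ.* B)       ≡⟨ pos-* n B ⟩
  + n * + B         ∎
  where open ≡-Reasoning

coprime⇒invertible : ∀ {a b} → Coprime a b → ∃ λ u → b ∣ a * u - 1ℤ
coprime⇒invertible {a} {b} coprime with ℕᶜ.coprime-Bézout coprime | i*±1≡∣i∣ a
... | ℕᵍ.Bézout.+- x y 1+yB≡xA | e , ae≡A =
  e * + x ,
  subst (b ∣_) (sym (+-case (pos-1+m*A≡n*B y (∣ b ∣) x (∣ a ∣) 1+yB≡xA))) (∣n⇒∣m*n (+ y) m∣∣m∣)
  where
  +-case : 1ℤ + + y * + ∣ b ∣ ≡ + x * + ∣ a ∣ → a * (e * + x) - 1ℤ ≡ + y * + ∣ b ∣
  +-case E = begin
    a * (e * + x) - 1ℤ      ≡⟨ cong (_- 1ℤ) (trans (sym (*-assoc a e (+ x))) (cong (_* + x) ae≡A)) ⟩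
    + ∣ a ∣ * + x - 1ℤ      ≡⟨ cong (_- 1ℤ) (trans (*-comm (+ ∣ a ∣) (+ x)) (sym E)) ⟩
    1ℤ + + y * + ∣ b ∣ - 1ℤ ≡⟨ cancel (+ y * + ∣ b ∣) ⟩
    + y * + ∣ b ∣           ∎
    where
    open ≡-Reasoning
    cancel : ∀ t → 1ℤ + t - 1ℤ ≡ t
    cancel = solve-∀
... | ℕᵍ.Bézout.-+ x y 1+xA≡yB | e , ae≡A =
  - (e * + x) ,
  subst (b ∣_) (sym (-+-case (pos-1+m*A≡n*B x (∣ a ∣) y (∣ b ∣) 1+xA≡yB)))
    (∣m⇒∣-m (∣n⇒∣m*n (+ y) m∣∣m∣))
  where
  -+-case : 1ℤ + + x * + ∣ a ∣ ≡ + y * + ∣ b ∣ → a * - (e * + x) - 1ℤ ≡ - (+ y * + ∣ b ∣)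
  -+-case E = begin
    a * - (e * + x) - 1ℤ       ≡⟨ negate a e (+ x) ⟩
    - (1ℤ + (a * e) * + x)     ≡⟨ cong (λ t → - (1ℤ + t * + x)) ae≡A ⟩
    - (1ℤ + + ∣ a ∣ * + x)     ≡⟨ cong (λ t → - (1ℤ + t)) (*-comm (+ ∣ a ∣) (+ x)) ⟩
    - (1ℤ + + x * + ∣ a ∣)     ≡⟨ cong -_ E ⟩
    - (+ y * + ∣ b ∣)          ∎
    where
    open ≡-Reasoning
    negate : ∀ a e x → a * - (e * x) - 1ℤ ≡ - (1ℤ + (a * e) * x)
    negate = solve-∀

inverse-resp-≡mod : ∀ a {b u x} → b ∣ x - u → b ∣ a * u - 1ℤ → b ∣ a * x - 1ℤ
inverse-resp-≡mod a {b} {u} {x} b∣x-u b∣au-1 =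
  subst (b ∣_) (rearrange a u x) (∣m∣n⇒∣m+n b∣au-1 (∣n⇒∣m*n a b∣x-u))
  where
  rearrange : ∀ a u x → (a * u - 1ℤ) + a * (x - u) ≡ a * x - 1ℤ
  rearrange = solve-∀

%-≡mod : ∀ u b .{{_ : NonZero b}} → b ∣ + (u % b) - u
%-≡mod u b = divides (- (u / b)) (begin
  + (u % b) - u                         ≡⟨ cong (λ t → + (u % b) - t) (a≡a%n+[a/n]*n u b) ⟩
  + (u % b) - (+ (u % b) + u / b * b)  ≡⟨ cancel (+ (u % b)) (u / b) b ⟩
  - (u / b) * b                         ∎)
  where
  open ≡-Reasoning
  cancel : ∀ r q b → r - (r + q * b) ≡ - q * b
  cancel = solve-∀

%-inverse : ∀ a u b .{{_ : NonZero b}} → b ∣ a * u - 1ℤ → b ∣ a * + (u % b) - 1ℤ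
%-inverse a u b = inverse-resp-≡mod a (%-≡mod u b)

∣-1⇒∣i∣≡1 : ∀ {i} → i ∣ -1ℤ → ∣ i ∣ ≡ 1
∣-1⇒∣i∣≡1 i∣-1 = ℕ∣.∣1⇒≡1 (∣⇒∣ᵤ i∣-1)

positive-inverse : ∀ a b .{{_ : NonZero b}} → ∣ b ∣ ≢ 1 → Coprime a b →
  ∃ λ r → b ∣ a * +[1+ r ] - 1ℤ × ℕ.suc r ℕ.< ∣ b ∣
positive-inverse a b ∣b∣≢1 coprime with coprime⇒invertible {a} {b} coprime
... | u , b∣au-1 with u % b | %-inverse a u b b∣au-1 | n%d<d u b
...   | zero    | b∣a0-1 | _   =
  contradiction (∣-1⇒∣i∣≡1 (subst (λ t → b ∣ t - 1ℤ) (*-zeroʳ a) b∣a0-1)) ∣b∣≢1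
...   | ℕ.suc r | b∣ar-1 | r<b = r , b∣ar-1 , r<b

isModInv-exists : ∀ {a b} → a ≢ 0ℤ → b ≢ 0ℤ → Coprime a b → ∃ (IsModInv a b)
isModInv-exists {+0}        a≢0 _   _ = contradiction refl a≢0
isModInv-exists {b = +0}    _   b≢0 _ = contradiction refl b≢0
isModInv-exists {+[1+ _ ]} {+[1+ 0 ]}  _ _ _ = 1ℤ , inj₂ (inj₂ (refl , refl))
isModInv-exists { -[1+ _ ]} {+[1+ 0 ]}  _ _ _ = 0ℤ , inj₂ (inj₂ (refl , refl))
isModInv-exists {+[1+ _ ]} { -[1+ 0 ]} _ _ _ = 0ℤ , inj₂ (inj₂ (refl , refl))
isModInv-exists { -[1+ _ ]} { -[1+ 0 ]} _ _ _ = -1ℤ , inj₂ (inj₂ (refl , refl))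
isModInv-exists {a} {b@(+[1+ ℕ.suc _ ])} _ _ coprime =
  let r , b∣ar-1 , r<b = positive-inverse a b (λ ()) coprime in
  +[1+ r ] , inj₁ (+<+ (s≤s (s≤s z≤n)) , +≤+ (s≤s z≤n) , +≤+ (ℕₚ.≤-pred r<b) , ∣⇒∣ᵤ b∣ar-1)
isModInv-exists {a} {b@(-[1+ ℕ.suc _ ])} _ _ coprime = shift-by-b (positive-inverse a b (λ ()) coprime)
  where
  shift-by-b : (∃ λ r → b ∣ a * +[1+ r ] - 1ℤ × ℕ.suc r ℕ.< ∣ b ∣) → ∃ (IsModInv a b)
  shift-by-b (r , b∣ar-1 , r<∣b∣) =
    +[1+ r ] + b , inj₂ (inj₁ (-<- (s≤s z≤n) , b+1≤r+b , r+b≤-1 ,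
      ∣⇒∣ᵤ (inverse-resp-≡mod a b∣[r+b]-r b∣ar-1)))
    where
    b∣[r+b]-r : b ∣ +[1+ r ] + b - +[1+ r ]
    b∣[r+b]-r = subst (b ∣_) (sym (cancel +[1+ r ] b)) ∣-refl
      where
      cancel : ∀ x b → x + b - x ≡ b
      cancel = solve-∀
    open ≤-Reasoning
    b+1≤r+b : b + 1ℤ ≤ +[1+ r ] + b
    b+1≤r+b = subst (_≤ +[1+ r ] + b) (+-comm 1ℤ b) (+-monoˡ-≤ b {1ℤ} {+[1+ r ]} (+≤+ (s≤s z≤n)))
    r+b≤-1 : +[1+ r ] + b ≤ -1ℤ
    r+b≤-1 = begin
      +[1+ r ] + b      ≤⟨ +-monoˡ-≤ b (+≤+ (ℕₚ.≤-pred r<∣b∣)) ⟩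
      (- b - 1ℤ) + b    ≡⟨ cancel b ⟩
      -1ℤ               ∎
      where
      cancel : ∀ b → (- b - 1ℤ) + b ≡ -1ℤ
      cancel = solve-∀

theorem3p1 : (a b : ℤ) → a ≢ 0ℤ → b ≢ 0ℤ → gcd a b ≡ 1ℤ →
    ∃ (λ x → IsModInv a b x) × ∃ (λ y → IsModInv b a y) ×
    ((x y : ℤ) → IsModInv a b x → IsModInv b a y →
      a * x + b * y ≡ 1ℤ + a * b)
theorem3p1 a b a≢0 b≢0 gcd≡1 =
  isModInv-exists a≢0 b≢0 coprime ,
  isModInv-exists b≢0 a≢0 (coprime-sym {a} {b} coprime) ,
  λ _ _ → isModInv-sum a≢0 b≢0 coprime
  where
  coprime : Coprime a b
  coprime = ℕᶜ.gcd≡1⇒coprime (+-injective gcd≡1)
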